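{- For all positive integers $n$ and integers $k>1$ with $n\ge 2^{k-3}$, \[\sqrt[k]{2^k n+2^{k-1}-1}<\sqrt[k]{n}+\sqrt[k]{n+1}.\]
   Context: $\sqrt[k]{\cdot}$ is the real positive $k$-th root. -}

module Defs where

open import Data.Nat as ℕ using (ℕ; zero; suc)
open import Data.Integer using (+_)
open import Data.Rational using (ℚ; 0ℚ; 1ℚ; _<_; _+_; _*_; _/_)
open import Data.Product using (Σ; _×_)
open import Data.Sum using (_⊎_)

_^ℚ_ : ℚ → ℕ → ℚ
q ^ℚ zero  = 1ℚ
q ^ℚ suc k = q * (q ^ℚ k)

ℕ→ℚ : ℕ → ℚ
ℕ→ℚ m = (+ m) / 1

-- Dedekind cuts of the real positive k-th root of m (k ≥ 1):
-- lower cut  L = { q | q < 0  or  q^k < m }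
-- upper cut  U = { q | 0 < q  and m < q^k }
InLowerRoot : ℕ → ℕ → ℚ → Set
InLowerRoot k m q = (q < 0ℚ) ⊎ (q ^ℚ k < ℕ→ℚ m)

InUpperRoot : ℕ → ℕ → ℚ → Set
InUpperRoot k m q = (0ℚ < q) × (ℕ→ℚ m < q ^ℚ k)

-- The real inequality  a^(1/k) < b^(1/k) + c^(1/k), read via Dedekind cuts:
-- x < y  iff some rational lies in the upper cut of x and the lower cut of y;
-- the lower cut of a sum of reals is { p + q | p ∈ L_b, q ∈ L_c }.
RootLtSumRoots : ℕ → ℕ → ℕ → ℕ → Set
RootLtSumRoots k a b c =
  Σ ℚ λ p → Σ ℚ λ q →
    InLowerRoot k b p × InLowerRoot k c q × InUpperRoot k a (p + q)

{-# OPTIONS --safe #-}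
-- With x = ᵏ√n and y = ᵏ√(n+1), AM-GM gives (x + y)^(2k) ≥ 4^k (xy)^k = 4^k n(n+1), while for
-- A = 2^k n + h - 1 with h = 2^(k-1) one has 4^k n(n+1) - A² = 4hn - (h-1)², which is positive
-- because h ≤ 4n, i.e. n ≥ 2^(k-3).  Being strict, the inequality survives replacing x, y by
-- rationals a/N, b/N just below them when N is large; these witness the Dedekind cuts.
module Submission where

open import Defs
open import Data.Nat using (ℕ; _+_; _*_; _∸_; _^_; _≤_)
open import Data.Nat using (zero; suc; _<_; s≤s; z≤n; _≤?_; NonZero)
open import Data.Nat.Properties
open import Data.Nat.Tactic.RingSolver using (solve-∀)
open import Data.Integer as ℤ using (+_; +<+)
import Data.Integer.Properties as ℤ
open import Data.Rational as ℚ using (ℚ; toℚᵘ)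
open import Data.Rational.Properties using (toℚᵘ-homo-*; toℚᵘ-homo-+; toℚᵘ-fromℚᵘ; toℚᵘ-cancel-<)
open import Data.Rational.Unnormalised as ℚᵘ using (ℚᵘ; mkℚᵘ; ↥_; ↧ₙ_; _≃_; *<*)
import Data.Rational.Unnormalised.Properties as ℚᵘ
open import Data.Product using (∃-syntax; _×_; _,_)
open import Data.Sum using (inj₁; inj₂)
open import Relation.Nullary using (yes; no; contradiction)
open import Relation.Binary.PropositionalEquality

^-distribʳ-* : ∀ m n k → (m * n) ^ k ≡ m ^ k * n ^ k
^-distribʳ-* m n zero    = refl
^-distribʳ-* m n (suc k) = trans (cong (m * n *_) (^-distribʳ-* m n k))
                                 ([m*n]*[o*p]≡[m*o]*[n*p] m n (m ^ k) (n ^ k))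

mono-≤⇒cancel-< : (f : ℕ → ℕ) → (∀ {m n} → m ≤ n → f m ≤ f n) → ∀ {m n} → f m < f n → m < n
mono-≤⇒cancel-< f f-mono fm<fn = ≰⇒> (λ n≤m → <⇒≱ fm<fn (f-mono n≤m))

^-cancelˡ-< : ∀ k {m n} → m ^ k < n ^ k → m < n
^-cancelˡ-< k = mono-≤⇒cancel-< (_^ k) (^-monoˡ-≤ k)

am-gm-≤ : ∀ {m n} → m ≤ n → 4 * (m * n) ≤ (m + n) * (m + n)
am-gm-≤ {m} m≤n with m≤n⇒∃[o]m+o≡n m≤n
... | d , refl = subst (4 * (m * (m + d)) ≤_) (sym (square-expansion m d))
                       (m≤m+n (4 * (m * (m + d))) (d * d))
  where
  square-expansion : ∀ m d → (m + (m + d)) * (m + (m + d)) ≡ 4 * (m * (m + d)) + d * d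
  square-expansion = solve-∀

am-gm : ∀ m n → 4 * (m * n) ≤ (m + n) * (m + n)
am-gm m n with ≤-total m n
... | inj₁ m≤n = am-gm-≤ m≤n
... | inj₂ n≤m = subst₂ (λ x y → 4 * x ≤ y * y) (*-comm n m) (+-comm n m) (am-gm-≤ n≤m)

am-gm-^ : ∀ k m n → 2 ^ k * 2 ^ k * (m ^ k * n ^ k) ≤ (m + n) ^ k * (m + n) ^ k
am-gm-^ k m n = begin
  2 ^ k * 2 ^ k * (m ^ k * n ^ k) ≡⟨ sym (cong₂ _*_ (^-distribʳ-* 2 2 k) (^-distribʳ-* m n k)) ⟩
  4 ^ k * (m * n) ^ k             ≡⟨ sym (^-distribʳ-* 4 (m * n) k) ⟩
  (4 * (m * n)) ^ k               ≤⟨ ^-monoˡ-≤ k (am-gm m n) ⟩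
  ((m + n) * (m + n)) ^ k         ≡⟨ ^-distribʳ-* (m + n) (m + n) k ⟩
  (m + n) ^ k * (m + n) ^ k       ∎
  where open ≤-Reasoning

suc-^-≤ : ∀ a j → suc a ^ suc j ≤ a ^ suc j + suc j * suc a ^ j
suc-^-≤ a zero    = ≤-reflexive (+-comm 1 (a * 1))
suc-^-≤ a (suc j) = begin
  suc a * suc a ^ suc j                            ≤⟨ *-monoʳ-≤ (suc a) (suc-^-≤ a j) ⟩
  suc a * (aᵏ + suc j * suc a ^ j)                 ≡⟨ expand a j aᵏ (suc a ^ j) ⟩
  a * aᵏ + aᵏ + suc j * suc a ^ suc j              ≤⟨ +-monoˡ-≤ (suc j * suc a ^ suc j)
                                                        (+-monoʳ-≤ (a * aᵏ) (^-monoˡ-≤ (suc j) (n≤1+n a))) ⟩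
  a * aᵏ + suc a ^ suc j + suc j * suc a ^ suc j   ≡⟨ collect (a * aᵏ) (suc a ^ suc j) j ⟩
  a * aᵏ + suc (suc j) * suc a ^ suc j             ∎
  where
  open ≤-Reasoning
  aᵏ = a ^ suc j
  expand : ∀ a j x y → (1 + a) * (x + (1 + j) * y) ≡ a * x + x + (1 + j) * ((1 + a) * y)
  expand = solve-∀
  collect : ∀ u v j → u + v + (1 + j) * v ≡ u + (2 + j) * v
  collect = solve-∀

root-between : ∀ j {M} B → 0 < M → M ≤ B ^ suc j → ∃[ a ] a ^ suc j < M × M ≤ suc a ^ suc j
root-between j zero    0<M M≤0 = contradiction M≤0 (<⇒≱ 0<M)
root-between j {M} (suc a) 0<M M≤[1+a]ᵏ with M ≤? a ^ suc j
... | yes M≤aᵏ = root-between j a 0<M M≤aᵏ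
... | no  M≰aᵏ = a , ≰⇒> M≰aᵏ , M≤[1+a]ᵏ

root-below : ∀ j {M B} → 0 < M → M ≤ B ^ suc j → ∃[ a ] a ^ suc j < M × M ≤ a ^ suc j + suc j * B ^ j
root-below j {M} {B} 0<M M≤Bᵏ with root-between j B 0<M M≤Bᵏ
... | a , aᵏ<M , M≤[1+a]ᵏ = a , aᵏ<M , (begin
  M                              ≤⟨ M≤[1+a]ᵏ ⟩
  suc a ^ suc j                  ≤⟨ suc-^-≤ a j ⟩
  a ^ suc j + suc j * suc a ^ j  ≤⟨ +-monoʳ-≤ (a ^ suc j) (*-monoʳ-≤ (suc j) (^-monoˡ-≤ j a<B)) ⟩
  a ^ suc j + suc j * B ^ j      ∎)
  where
  open ≤-Reasoning
  a<B : a < B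
  a<B = ^-cancelˡ-< (suc j) (<-≤-trans aᵏ<M M≤Bᵏ)

gap-survives-approximation : ∀ {T W D X Y M₁ M₂ E} →
  X ≤ M₁ → Y ≤ M₂ → M₁ ≤ X + E → M₂ ≤ Y + E →
  T * (E * (M₁ + M₂ + E)) < D * D → W * W + D * D ≤ T * (M₁ * M₂) →
  W * W < T * (X * Y)
gap-survives-approximation {T} {W} {D} {X} {Y} {M₁} {M₂} {E} X≤M₁ Y≤M₂ M₁≤X+E M₂≤Y+E error<D² gap =
  +-cancelʳ-< (D * D) (W * W) (T * (X * Y)) (begin-strict
    W * W + D * D                          ≤⟨ gap ⟩
    T * (M₁ * M₂)                          ≤⟨ *-monoʳ-≤ T (*-mono-≤ M₁≤X+E M₂≤Y+E) ⟩
    T * ((X + E) * (Y + E))                ≡⟨ expand T X Y E ⟩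
    T * (X * Y) + T * (E * (X + Y + E))    ≤⟨ +-monoʳ-≤ (T * (X * Y))
                                                (*-monoʳ-≤ T (*-monoʳ-≤ E (+-monoˡ-≤ E (+-mono-≤ X≤M₁ Y≤M₂)))) ⟩
    T * (X * Y) + T * (E * (M₁ + M₂ + E))  <⟨ +-monoʳ-< (T * (X * Y)) error<D² ⟩
    T * (X * Y) + D * D                    ∎)
  where
  open ≤-Reasoning
  expand : ∀ T X Y E → T * ((X + E) * (Y + E)) ≡ T * (X * Y) + T * (E * (X + Y + E))
  expand = solve-∀

rational-approximation : ∀ j n A → 1 ≤ n → A * A < 2 ^ suc j * 2 ^ suc j * (n * suc n) →
  ∃[ a ] ∃[ b ] ∃[ d ] a ^ suc j < n * suc d ^ suc j × b ^ suc j < suc n * suc d ^ suc j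
                     × A * suc d ^ suc j < (a + b) ^ suc j
rational-approximation j n A 1≤n A²<T·n[n+1] =
  let a , aᵏ<M₁ , M₁≤aᵏ+E = root-below j 0<M₁ M₁≤Bᵏ
      b , bᵏ<M₂ , M₂≤bᵏ+E = root-below j 0<M₂ M₂≤Bᵏ
  in a , b , K , aᵏ<M₁ , bᵏ<M₂ , sum-above a b aᵏ<M₁ bᵏ<M₂ M₁≤aᵏ+E M₂≤bᵏ+E
  where
  k = suc j
  T = 2 ^ k * 2 ^ k
  C = suc n
  c = k * C ^ j
  -- chosen so that the error term in error<D² is at most K N^(2k-1) < N^(2k)
  K = T * (c * (2 * C + c))
  N = suc K
  D = N ^ k
  M₁ = n * D
  M₂ = C * D
  B = C * N
  E = k * B ^ j
  0<M₁ : 0 < M₁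
  0<M₁ = *-mono-≤ 1≤n (m^n>0 N k)
  0<M₂ : 0 < M₂
  0<M₂ = *-mono-≤ {1} {C} (s≤s z≤n) (m^n>0 N k)
  C≤Cᵏ : C ≤ C ^ k
  C≤Cᵏ = m≤m*n C (C ^ j) {{m^n≢0 C j}}
  M₁≤Bᵏ : M₁ ≤ B ^ k
  M₁≤Bᵏ = subst (M₁ ≤_) (sym (^-distribʳ-* C N k)) (*-monoˡ-≤ D (≤-trans (n≤1+n n) C≤Cᵏ))
  M₂≤Bᵏ : M₂ ≤ B ^ k
  M₂≤Bᵏ = subst (M₂ ≤_) (sym (^-distribʳ-* C N k)) (*-monoˡ-≤ D C≤Cᵏ)
  product-gap : A * D * (A * D) + D * D ≤ T * (M₁ * M₂)
  product-gap = begin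
    A * D * (A * D) + D * D  ≡⟨ factor A D ⟩
    suc (A * A) * (D * D)    ≤⟨ *-monoˡ-≤ (D * D) A²<T·n[n+1] ⟩
    T * (n * C) * (D * D)    ≡⟨ regroup T n C D ⟩
    T * (M₁ * M₂)            ∎
    where
    open ≤-Reasoning
    factor : ∀ A D → A * D * (A * D) + D * D ≡ (1 + A * A) * (D * D)
    factor = solve-∀
    regroup : ∀ T n C D → T * (n * C) * (D * D) ≡ T * (n * D * (C * D))
    regroup = solve-∀
  E≡c·Nʲ : E ≡ c * N ^ j
  E≡c·Nʲ = trans (cong (k *_) (^-distribʳ-* C N j)) (sym (*-assoc k (C ^ j) (N ^ j)))
  M₁+M₂+E≤ : M₁ + M₂ + E ≤ (2 * C + c) * D
  M₁+M₂+E≤ = begin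
    M₁ + M₂ + E                ≤⟨ +-mono-≤ (+-monoˡ-≤ M₂ (*-monoˡ-≤ D (n≤1+n n))) (≤-reflexive E≡c·Nʲ) ⟩
    C * D + C * D + c * N ^ j  ≤⟨ +-monoʳ-≤ (C * D + C * D) (*-monoʳ-≤ c (m≤n*m (N ^ j) N)) ⟩
    C * D + C * D + c * D      ≡⟨ collect C D c ⟩
    (2 * C + c) * D            ∎
    where
    open ≤-Reasoning
    collect : ∀ C D c → C * D + C * D + c * D ≡ (2 * C + c) * D
    collect = solve-∀
  error<D² : T * (E * (M₁ + M₂ + E)) < D * D
  error<D² = begin-strict
    T * (E * (M₁ + M₂ + E))              ≤⟨ *-monoʳ-≤ T (*-mono-≤ (≤-reflexive E≡c·Nʲ) M₁+M₂+E≤) ⟩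
    T * (c * N ^ j * ((2 * C + c) * D))  ≡⟨ regroup T c (N ^ j) C D ⟩
    K * (N ^ j * D)                      <⟨ *-monoˡ-< (N ^ j * D) {{Nʲ·D≢0}} (n<1+n K) ⟩
    N * (N ^ j * D)                      ≡⟨ sym (*-assoc N (N ^ j) D) ⟩
    D * D                                ∎
    where
    open ≤-Reasoning
    regroup : ∀ T c x C D → T * (c * x * ((2 * C + c) * D)) ≡ T * (c * (2 * C + c)) * (x * D)
    regroup = solve-∀
    Nʲ·D≢0 : NonZero (N ^ j * D)
    Nʲ·D≢0 = m*n≢0 (N ^ j) D {{m^n≢0 N j}} {{m^n≢0 N k}}
  sum-above : ∀ a b → a ^ k < M₁ → b ^ k < M₂ → M₁ ≤ a ^ k + E → M₂ ≤ b ^ k + E →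
              A * D < (a + b) ^ k
  sum-above a b aᵏ<M₁ bᵏ<M₂ M₁≤aᵏ+E M₂≤bᵏ+E =
    mono-≤⇒cancel-< (λ x → x * x) (λ m≤n → *-mono-≤ m≤n m≤n) (begin-strict
      A * D * (A * D)            <⟨ gap-survives-approximation {T} {A * D} {D} (<⇒≤ aᵏ<M₁) (<⇒≤ bᵏ<M₂)
                                      M₁≤aᵏ+E M₂≤bᵏ+E error<D² product-gap ⟩
      T * (a ^ k * b ^ k)        ≤⟨ am-gm-^ k a b ⟩
      (a + b) ^ k * (a + b) ^ k  ∎)
    where open ≤-Reasoning

square-gap : ∀ h n → 0 < h → h ≤ 4 * n →
  (2 * h * n + h ∸ 1) * (2 * h * n + h ∸ 1) < 2 * h * (2 * h) * (n * suc n)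
square-gap (suc g) n _ h≤4n = subst (λ x → x * x < 2 * h * (2 * h) * (n * suc n)) (sym A≡2hn+g)
  (+-cancelʳ-< (g * g) _ _ (begin-strict
    (2 * h * n + g) * (2 * h * n + g) + g * g        <⟨ +-monoʳ-< _ g²<h·4n ⟩
    (2 * h * n + g) * (2 * h * n + g) + h * (4 * n)  ≡⟨ completing-square g n ⟩
    2 * h * (2 * h) * (n * suc n) + g * g            ∎))
  where
  open ≤-Reasoning
  h = suc g
  A≡2hn+g : 2 * h * n + h ∸ 1 ≡ 2 * h * n + g
  A≡2hn+g = cong (_∸ 1) (+-suc (2 * h * n) g)
  g²<h·4n : g * g < h * (4 * n)
  g²<h·4n = <-≤-trans (*-mono-< (n<1+n g) (n<1+n g)) (*-monoʳ-≤ h h≤4n)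
  completing-square : ∀ g n → (2 * (1 + g) * n + g) * (2 * (1 + g) * n + g) + (1 + g) * (4 * n)
                            ≡ 2 * (1 + g) * (2 * (1 + g)) * (n * (1 + n)) + g * g
  completing-square = solve-∀

2^[1+c]≤4*n : ∀ c {n} → 1 ≤ n → 2 ^ (c ∸ 1) ≤ n → 2 ^ suc c ≤ 4 * n
2^[1+c]≤4*n zero        1≤n _    = ≤-trans (s≤s (s≤s z≤n)) (*-monoʳ-≤ 4 1≤n)
2^[1+c]≤4*n (suc c) {n} _ 2ᶜ≤n = subst (_≤ 4 * n) (*-assoc 2 2 (2 ^ c)) (*-monoʳ-≤ 4 2ᶜ≤n)

-- p ≐ X / D: p equals an unnormalised fraction whose numerator and denominator are literally
-- X and D, so that comparisons of such fractions reduce to comparisons in ℕ.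
infix 4 _≐_/_
record _≐_/_ (p : ℚ) (X D : ℕ) : Set where
  constructor ≐-by
  field
    rep        : ℚᵘ
    toℚᵘ-p≃rep : toℚᵘ p ≃ rep
    ↥rep≡X     : ↥ rep ≡ + X
    ↧rep≡D     : ↧ₙ rep ≡ D

↥-* : ∀ u v → ↥ (u ℚᵘ.* v) ≡ ↥ u ℤ.* ↥ v
↥-* (mkℚᵘ _ _) (mkℚᵘ _ _) = refl

↧ₙ-* : ∀ u v → ↧ₙ (u ℚᵘ.* v) ≡ ↧ₙ u * ↧ₙ v
↧ₙ-* (mkℚᵘ _ _) (mkℚᵘ _ _) = refl

↥-+ : ∀ u v → ↥ (u ℚᵘ.+ v) ≡ ↥ u ℤ.* ℚᵘ.↧ v ℤ.+ ↥ v ℤ.* ℚᵘ.↧ u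
↥-+ (mkℚᵘ _ _) (mkℚᵘ _ _) = refl

↧ₙ-+ : ∀ u v → ↧ₙ (u ℚᵘ.+ v) ≡ ↧ₙ u * ↧ₙ v
↧ₙ-+ (mkℚᵘ _ _) (mkℚᵘ _ _) = refl

↥*↧ : ∀ u v {X E} → ↥ u ≡ + X → ↧ₙ v ≡ E → ↥ u ℤ.* ℚᵘ.↧ v ≡ + (X * E)
↥*↧ _ _ {X} {E} ↥u≡X ↧v≡E = trans (cong₂ ℤ._*_ ↥u≡X (cong +_ ↧v≡E)) (sym (ℤ.pos-* X E))

/-≐ : ∀ X D .{{_ : NonZero D}} → + X ℚ./ D ≐ X / D
/-≐ X (suc D) = ≐-by (mkℚᵘ (+ X) D) (toℚᵘ-fromℚᵘ (mkℚᵘ (+ X) D)) refl refl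

*-≐ : ∀ {p q X Y D E} → p ≐ X / D → q ≐ Y / E → p ℚ.* q ≐ X * Y / (D * E)
*-≐ {p} {q} {X} {Y} (≐-by u p≃u ↥u ↧u) (≐-by v q≃v ↥v ↧v) = ≐-by (u ℚᵘ.* v)
  (ℚᵘ.≃-trans (toℚᵘ-homo-* p q) (ℚᵘ.*-cong p≃u q≃v))
  (trans (↥-* u v) (trans (cong₂ ℤ._*_ ↥u ↥v) (sym (ℤ.pos-* X Y))))
  (trans (↧ₙ-* u v) (cong₂ _*_ ↧u ↧v))

+-≐ : ∀ {p q X Y D E} → p ≐ X / D → q ≐ Y / E → p ℚ.+ q ≐ X * E + Y * D / (D * E)
+-≐ {p} {q} {X} {Y} {D} {E} (≐-by u p≃u ↥u ↧u) (≐-by v q≃v ↥v ↧v) = ≐-by (u ℚᵘ.+ v)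
  (ℚᵘ.≃-trans (toℚᵘ-homo-+ p q) (ℚᵘ.+-cong p≃u q≃v))
  (trans (↥-+ u v) (trans (cong₂ ℤ._+_ (↥*↧ u v ↥u ↧v) (↥*↧ v u ↥v ↧u))
                          (sym (ℤ.pos-+ (X * E) (Y * D)))))
  (trans (↧ₙ-+ u v) (cong₂ _*_ ↧u ↧v))

^-≐ : ∀ k {p X D} → p ≐ X / D → p ^ℚ k ≐ X ^ k / D ^ k
^-≐ zero    _   = ≐-by ℚᵘ.1ℚᵘ ℚᵘ.≃-refl refl refl
^-≐ (suc k) p≐ = *-≐ p≐ (^-≐ k p≐)

≐-< : ∀ {p q X Y D E} → p ≐ X / D → q ≐ Y / E → X * E < Y * D → p ℚ.< q
≐-< (≐-by u p≃u ↥u ↧u) (≐-by v q≃v ↥v ↧v) XE<YD = toℚᵘ-cancel-<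
  (ℚᵘ.<-respˡ-≃ (ℚᵘ.≃-sym p≃u) (ℚᵘ.<-respʳ-≃ (ℚᵘ.≃-sym q≃v)
    (*<* (subst₂ ℤ._<_ (sym (↥*↧ u v ↥u ↧v)) (sym (↥*↧ v u ↥v ↧u)) (+<+ XE<YD)))))

fraction-inLowerRoot : ∀ k m a d → a ^ k < m * suc d ^ k → InLowerRoot k m (+ a ℚ./ suc d)
fraction-inLowerRoot k m a d aᵏ<m·Nᵏ = inj₂ (≐-< (^-≐ k (/-≐ a (suc d))) (/-≐ m 1)
  (subst (_< m * suc d ^ k) (sym (*-identityʳ (a ^ k))) aᵏ<m·Nᵏ))

fraction-sum-inUpperRoot : ∀ j A a b d → A * suc d ^ suc j < (a + b) ^ suc j →
  InUpperRoot (suc j) A (+ a ℚ./ suc d ℚ.+ + b ℚ./ suc d)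
fraction-sum-inUpperRoot j A a b d A·Nᵏ<[a+b]ᵏ =
  ≐-< (/-≐ 0 1) sum≐ 0<S·1 , ≐-< (/-≐ A 1) (^-≐ k sum≐) A·[N·N]ᵏ<Sᵏ·1
  where
  k = suc j
  N = suc d
  S = a * N + b * N
  sum≐ : + a ℚ./ N ℚ.+ + b ℚ./ N ≐ S / (N * N)
  sum≐ = +-≐ (/-≐ a N) (/-≐ b N)
  S≡[a+b]N : S ≡ (a + b) * N
  S≡[a+b]N = sym (*-distribʳ-+ N a b)
  0<S·1 : 0 < S * 1
  0<S·1 = subst (0 <_) (sym (trans (*-identityʳ S) S≡[a+b]N))
                (*-mono-≤ (^-cancelˡ-< k {0} {a + b} (≤-<-trans z≤n A·Nᵏ<[a+b]ᵏ)) (s≤s (z≤n {d})))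
  A·[N·N]ᵏ<Sᵏ·1 : A * (N * N) ^ k < S ^ k * 1
  A·[N·N]ᵏ<Sᵏ·1 = begin-strict
    A * (N * N) ^ k          ≡⟨ cong (A *_) (^-distribʳ-* N N k) ⟩
    A * (N ^ k * N ^ k)      ≡⟨ sym (*-assoc A (N ^ k) (N ^ k)) ⟩
    A * N ^ k * N ^ k        <⟨ *-monoˡ-< (N ^ k) {{m^n≢0 N k}} A·Nᵏ<[a+b]ᵏ ⟩
    (a + b) ^ k * N ^ k      ≡⟨ sym (^-distribʳ-* (a + b) N k) ⟩
    ((a + b) * N) ^ k        ≡⟨ cong (_^ k) (sym S≡[a+b]N) ⟩
    S ^ k                    ≡⟨ sym (*-identityʳ (S ^ k)) ⟩
    S ^ k * 1                ∎
    where open ≤-Reasoning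

lemma11 : (n k : ℕ) → 1 ≤ n → 2 ≤ k → 2 ^ (k ∸ 3) ≤ n →
            RootLtSumRoots k (2 ^ k * n + 2 ^ (k ∸ 1) ∸ 1) n (n + 1)
lemma11 n (suc (suc c)) 1≤n (s≤s (s≤s z≤n)) 2ᵏ⁻³≤n =
  let A²<4ᵏn[n+1] = square-gap (2 ^ suc c) n (m^n>0 2 (suc c)) (2^[1+c]≤4*n c 1≤n 2ᵏ⁻³≤n)
      a , b , d , aᵏ<n·Nᵏ , bᵏ<[1+n]Nᵏ , A·Nᵏ<[a+b]ᵏ =
        rational-approximation (suc c) n A 1≤n A²<4ᵏn[n+1]
  in + a ℚ./ suc d , + b ℚ./ suc d
   , fraction-inLowerRoot (suc (suc c)) n a d aᵏ<n·Nᵏ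
   , fraction-inLowerRoot (suc (suc c)) (n + 1) b d
       (subst (λ m → b ^ suc (suc c) < m * suc d ^ suc (suc c)) (+-comm 1 n) bᵏ<[1+n]Nᵏ)
   , fraction-sum-inUpperRoot (suc c) A a b d A·Nᵏ<[a+b]ᵏ
  where
  A = 2 ^ suc (suc c) * n + 2 ^ suc c ∸ 1
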